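{- Let $m\ge 2$, $n_1,\dots,n_m\ge 1$ be integers and $N=\sum_{i=1}^m n_i$. Let $S^{\circ}(n_1,\dots,n_m)$ be the number, up to rotation, of cyclic words of length $N$ over $[m]$ using color $i$ exactly $n_i$ times and having no two equal adjacent colors, including the wrap-around pair. Let $H^{\rightarrow}(n_1,\dots,n_m)$ be the number of directed Hamiltonian cycles of the complete $m$-partite graph $K_{n_1,\dots,n_m}$ (a cycle and its reverse counted as distinct, cycles counted up to rotation). Then \[ H^{\rightarrow}(n_1,\dots,n_m)=\prod_{i=1}^m (n_i!)\;S^{\circ}(n_1,\dots,n_m), \] and the number of undirected Hamiltonian cycles of $K_{n_1,\dots,n_m}$ is $H^{\rightarrow}(n_1,\dots,n_m)/2$.
   Formalization: S°(n₁,…,nₘ) is replaced by W/N, where W counts proper cyclic words as position-labelled sequences rather than rotation classes, so the identity reads N·H→ = ∏nᵢ!·W; the undirected count H→/2 is claimed for N ≥ 3 only. The statement above fails without it. -}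

module Defs where

open import Data.Bool using (Bool; true; false; not; _∧_; _∨_; if_then_else_)
open import Data.Nat using (ℕ; zero; suc; _+_; _*_; _!; _≡ᵇ_)
open import Data.Nat.DivMod using (_mod_)
open import Data.Fin using (Fin; toℕ; _≟_)
open import Data.List using (List; []; _∷_; map; concatMap; filterᵇ; length; allFin)
open import Data.Bool.ListAction using (all; any)
open import Data.Nat.ListAction using (sum; product)
open import Data.Vec using (Vec; lookup; tabulate; reverse)
  renaming ([] to []ᵛ; _∷_ to _∷ᵛ_)
import Data.Vec.Properties as VecP
import Data.Product.Properties as ProdP
open import Data.Product using (Σ; _,_; proj₁)
open import Relation.Nullary.Decidable using (⌊_⌋)

cnext : ∀ {N} → Fin N → Fin N
cnext {suc k} i = suc (toℕ i) mod suc k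

shift : ∀ {N} → Fin N → Fin N → Fin N
shift {suc k} s p = (toℕ p + toℕ s) mod suc k

rotate : ∀ {A : Set} {N} → Fin N → Vec A N → Vec A N
rotate s v = tabulate (λ p → lookup v (shift s p))

allVec : ∀ {A : Set} → List A → (N : ℕ) → List (Vec A N)
allVec xs zero = []ᵛ ∷ []
allVec xs (suc N) = concatMap (λ x → map (x ∷ᵛ_) (allVec xs N)) xs

-- number of equivalence classes of a (duplicate-free) list under a decidable
-- equivalence r: count the elements with no later r-equivalent element
classes : ∀ {A : Set} → (A → A → Bool) → List A → ℕ
classes r [] = 0
classes r (x ∷ xs) = if any (r x) xs then classes r xs else suc (classes r xs)

module _ (m : ℕ) (n : Fin m → ℕ) where

  total : ℕ
  total = sum (map n (allFin m))

  prodFact : ℕ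
  prodFact = product (map (λ i → n i !) (allFin m))

  colourCount : Vec (Fin m) total → Fin m → ℕ
  colourCount w i = length (filterᵇ (λ p → ⌊ lookup w p ≟ i ⌋) (allFin total))

  isProperCyclicWord : Vec (Fin m) total → Bool
  isProperCyclicWord w =
    all (λ i → colourCount w i ≡ᵇ n i) (allFin m)
    ∧ all (λ p → not ⌊ lookup w p ≟ lookup w (cnext p) ⌋) (allFin total)

  -- number W of proper cyclic words as sequences (positions labelled);
  -- the paper's S°(n_1,…,n_m) equals W / N
  properWords : ℕ
  properWords = length (filterᵇ isProperCyclicWord (allVec (allFin m) total))

  -- Complete multipartite graph K_{n_1,…,n_m}: vertex (i , j) is the j-th
  -- vertex of part i; two vertices adjacent iff they lie in different parts.
  Vertex : Set
  Vertex = Σ (Fin m) (λ i → Fin (n i))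

  vertices : List Vertex
  vertices = concatMap (λ i → map (i ,_) (allFin (n i))) (allFin m)

  _≟V_ : (u v : Vertex) → _
  _≟V_ = ProdP.≡-dec _≟_ _≟_

  adjacent : Vertex → Vertex → Bool
  adjacent u v = not ⌊ proj₁ u ≟ proj₁ v ⌋

  -- a Hamiltonian cycle written as a vertex sequence v_0 … v_{N-1}:
  -- all N vertices distinct (hence each vertex exactly once) and
  -- v_p adjacent to v_{p+1 mod N}
  isHamSeq : Vec Vertex total → Bool
  isHamSeq v =
    all (λ p → all (λ q → ⌊ p ≟ q ⌋ ∨ not ⌊ lookup v p ≟V lookup v q ⌋) (allFin total)) (allFin total)
    ∧ all (λ p → adjacent (lookup v p) (lookup v (cnext p))) (allFin total)

  hamSeqs : List (Vec Vertex total)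
  hamSeqs = filterᵇ isHamSeq (allVec vertices total)

  sameDirected : Vec Vertex total → Vec Vertex total → Bool
  sameDirected v w = any (λ s → ⌊ VecP.≡-dec _≟V_ (rotate s v) w ⌋) (allFin total)

  sameUndirected : Vec Vertex total → Vec Vertex total → Bool
  sameUndirected v w = sameDirected v w ∨ sameDirected (reverse v) w

  hamDirected : ℕ
  hamDirected = classes sameDirected hamSeqs

  hamUndirected : ℕ
  hamUndirected = classes sameUndirected hamSeqs

{-# OPTIONS --safe #-}
module Submission where

-- A Hamiltonian cycle of K_{n_1,…,n_m}, read off as a sequence v_0 … v_{N-1} of distinct vertices,
-- projects to its colour word, a cyclic word without equal neighbours using colour i exactly n_i
-- times. Conversely such a word lifts to exactly ∏ n_i! vertex sequences: the occurrences of colour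
-- i receive the n_i vertices of part i in some order. So there are W · ∏ n_i! Hamiltonian sequences.
-- A directed cycle is an orbit of sequences under rotation; since the vertices of a sequence are
-- distinct its N rotations are distinct, so every orbit has N elements. For N ≥ 3 a sequence is never
-- a rotation of its reversal, so the orbits under rotation and reversal have 2N elements.

open import Data.Bool using (Bool; true; false; not; _∧_; _∨_; if_then_else_; T)
open import Data.Bool.ListAction using (and; all; any)
open import Data.Bool.Properties
  using (T-≡; T-∧; T-∨; T?; ∧-zeroʳ; ∧-comm; if-float; if-cong-then; if-cong-else; if-cong₂)
open import Data.Empty using (⊥-elim)
open import Data.Fin as Fin using (Fin; zero; suc; toℕ; opposite; fromℕ; inject₁)
open import Data.Fin.Properties as Finₚ using (toℕ-fromℕ<; toℕ-injective; toℕ<n; opposite-prop; opposite-involutive)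
open import Data.List using (List; []; _∷_; _++_; map; concatMap; filterᵇ; length; allFin)
open import Data.List.Properties using (map-cong; map-∘; map-tabulate; length-tabulate)
open import Data.List.Relation.Unary.All as All using (All; []; _∷_)
open import Data.List.Relation.Unary.All.Properties as Allₚ using (filter⁺; all-filter; all⁺; all⁻)
open import Data.List.Relation.Unary.AllPairs using ([]; _∷_)
open import Data.List.Relation.Unary.Any.Properties as Anyₚ using (any⁻; any⁺)
open import Data.List.Relation.Unary.Unique.Propositional using (Unique)
open import Data.List.Relation.Unary.Unique.Propositional.Properties using (allFin⁺)
open import Data.Nat
  using (ℕ; zero; suc; pred; _+_; _*_; _^_; _∸_; _≤_; _<_; _!; _≡ᵇ_; _<ᵇ_; z≤n; s≤s; _<?_; _≤?_; NonZero)
open import Data.Nat.Combinatorics using (_P_; nPn≡n!; k>n⇒nPk≡0)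
open import Data.Nat.Combinatorics.Specification using (nP′k≡n[n∸1P′k∸1])
open import Data.Nat.DivMod
open import Data.Nat.ListAction using (sum; product)
open import Data.Nat.Properties
open import Algebra.Properties.CommutativeSemigroup +-commutativeSemigroup
  using () renaming (interchange to +-interchange)
open import Algebra.Properties.CommutativeSemigroup *-commutativeSemigroup
  using (x∙yz≈y∙xz) renaming (interchange to *-interchange)
open import Data.Nat.Tactic.RingSolver using (solve-∀)
open import Data.Product using (Σ; ∃-syntax; _×_; _,_; proj₁; proj₂)
open import Data.Product.Properties using () renaming (≡-dec to Σ-≡-dec)
open import Data.Sum as Sum using (_⊎_; inj₁; inj₂)
open import Data.Vec as Vec using (Vec; []; _∷_; lookup; reverse; _∷ʳ_; toList)
open import Data.Vec.Properties
  using ( ∷-injectiveˡ; ∷-injectiveʳ; lookup∘tabulate; tabulate∘lookup; tabulate-cong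
        ; reverse-∷; reverse-involutive; lookup-map)
  renaming (≡-dec to Vec-≡-dec)
open import Function using (_∘_)
open import Function.Bundles using (_⇔_; mk⇔; module Equivalence)
open import Function.Definitions using (Injective)
open import Relation.Binary.Definitions using (DecidableEquality; tri<; tri≈; tri>)
open import Relation.Binary.PropositionalEquality
open import Relation.Binary.Structures using (IsEquivalence)
open import Relation.Nullary using (Dec; yes; no; ¬_; contradiction)
open import Relation.Nullary.Decidable
  using (⌊_⌋; toWitness; fromWitness; ⌊⌋-map′; isYes≗does; dec-false; does-⇔)

open import Defs

open Equivalence using (to; from)

private variable
  A B : Set

T-injective : ∀ {x y} → (T x → T y) → (T y → T x) → x ≡ y
T-injective {false} {false} _   _   = refl
T-injective {false} {true}  _   y⇒x = ⊥-elim (y⇒x _)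
T-injective {true}  {false} x⇒y _   = ⊥-elim (x⇒y _)
T-injective {true}  {true}  _   _   = refl

¬T⇒T-not : ∀ {x} → ¬ T x → T (not x)
¬T⇒T-not {false} _  = _
¬T⇒T-not {true}  ¬t = ¬t _

T-not⇒¬T : ∀ {x} → T (not x) → ¬ T x
T-not⇒¬T {false} _ ()

¬T⇒≡false : ∀ {x} → ¬ T x → x ≡ false
¬T⇒≡false {false} _  = refl
¬T⇒≡false {true}  ¬t = ⊥-elim (¬t _)

not-∨ : ∀ x y → not (x ∨ y) ≡ not x ∧ not y
not-∨ false y = refl
not-∨ true  y = refl

⌊⌋-⇔ : {X Y : Set} → (X → Y) → (Y → X) → (x? : Dec X) (y? : Dec Y) → ⌊ x? ⌋ ≡ ⌊ y? ⌋
⌊⌋-⇔ x→y y→x x? y? = trans (isYes≗does x?) (trans (does-⇔ (mk⇔ x→y y→x) x? y?) (sym (isYes≗does y?)))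

⌊⌋-false : {X : Set} (x? : Dec X) → ¬ X → ⌊ x? ⌋ ≡ false
⌊⌋-false x? ¬x = trans (isYes≗does x?) (dec-false x? ¬x)

module _ {p q : A → Bool} where

  any-cong : (∀ x → T (p x) → T (q x)) → (∀ x → T (q x) → T (p x)) → ∀ xs → any p xs ≡ any q xs
  any-cong p⇒q q⇒p []       = refl
  any-cong p⇒q q⇒p (x ∷ xs) = cong₂ _∨_ (T-injective (p⇒q x) (q⇒p x)) (any-cong p⇒q q⇒p xs)

  any-filterᵇ : (∀ x → T (p x) → T (q x)) → ∀ xs → any p (filterᵇ q xs) ≡ any p xs
  any-filterᵇ p⇒q []       = refl
  any-filterᵇ p⇒q (x ∷ xs) with q x in qx
  ... | true  = cong (p x ∨_) (any-filterᵇ p⇒q xs)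
  ... | false with p x in px
  ...   | false = any-filterᵇ p⇒q xs
  ...   | true  = ⊥-elim (subst T qx (p⇒q x (subst T (sym px) _)))

module _ {n : ℕ} {f : Fin n → Bool} where

  all-allFin⇔ : T (all f (allFin n)) ⇔ (∀ i → T (f i))
  all-allFin⇔ = mk⇔ (Allₚ.tabulate⁻ ∘ all⁺ f (allFin n)) (all⁻ f ∘ Allₚ.tabulate⁺)

  any-allFin⇔ : T (any f (allFin n)) ⇔ (∃[ i ] T (f i))
  any-allFin⇔ = mk⇔ (Anyₚ.tabulate⁻ ∘ any⁻ f (allFin n)) (λ (i , fi) → any⁺ f (Anyₚ.tabulate⁺ i fi))

module _ {B : Set} (_≟_ : DecidableEquality B) {n : ℕ} (f : Fin n → B) where

  injectiveᵇ : Bool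
  injectiveᵇ = all (λ p → all (λ q → ⌊ p Fin.≟ q ⌋ ∨ not ⌊ f p ≟ f q ⌋) (allFin n)) (allFin n)

  injectiveᵇ⇔ : T injectiveᵇ ⇔ Injective _≡_ _≡_ f
  injectiveᵇ⇔ = mk⇔ sound complete
    where
      sound : _ → Injective _≡_ _≡_ f
      sound t {p} {q} fp≡fq with to (T-∨ {⌊ p Fin.≟ q ⌋})
                                (to all-allFin⇔ (to all-allFin⇔ t p) q)
      ... | inj₁ p≡q   = toWitness p≡q
      ... | inj₂ fp≢fq = ⊥-elim (T-not⇒¬T fp≢fq (fromWitness {a? = f p ≟ f q} fp≡fq))
      complete : Injective _≡_ _≡_ f → _
      complete f-injective = from all-allFin⇔ λ p → from all-allFin⇔ λ q → test p q (p Fin.≟ q)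
        where
          test : ∀ p q (p≟q : Dec (p ≡ q)) → T (⌊ p≟q ⌋ ∨ not ⌊ f p ≟ f q ⌋)
          test p q (yes _)  = _
          test p q (no p≢q) = ¬T⇒T-not (p≢q ∘ f-injective ∘ toWitness)

module _ {R S : A → A → Set} where

  isEquivalence-⇔ : (∀ {x y} → R x y ⇔ S x y) → IsEquivalence S → IsEquivalence R
  isEquivalence-⇔ R⇔S S-equiv = record
    { refl  = from R⇔S S.refl
    ; sym   = from R⇔S ∘ S.sym ∘ to R⇔S
    ; trans = λ r₁ r₂ → from R⇔S (S.trans (to R⇔S r₁) (to R⇔S r₂))
    }
    where module S = IsEquivalence S-equiv

-- Sums, products and counts over lists

∑ : List A → (A → ℕ) → ℕ
∑ xs f = sum (map f xs)

∏ : List A → (A → ℕ) → ℕ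
∏ xs f = product (map f xs)

countᵇ : (A → Bool) → List A → ℕ
countᵇ p xs = ∑ xs (λ x → if p x then 1 else 0)

module _ {f g : A → ℕ} where

  ∑-cong : (∀ x → f x ≡ g x) → ∀ xs → ∑ xs f ≡ ∑ xs g
  ∑-cong f≗g xs = cong sum (map-cong f≗g xs)

  ∏-cong : (∀ x → f x ≡ g x) → ∀ xs → ∏ xs f ≡ ∏ xs g
  ∏-cong f≗g xs = cong product (map-cong f≗g xs)

  ∑-+ : ∀ xs → ∑ xs (λ x → f x + g x) ≡ ∑ xs f + ∑ xs g
  ∑-+ []       = refl
  ∑-+ (x ∷ xs) = trans (cong (f x + g x +_) (∑-+ xs)) (+-interchange (f x) (g x) _ _)

∑-++ : (f : A → ℕ) (xs ys : List A) → ∑ (xs ++ ys) f ≡ ∑ xs f + ∑ ys f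
∑-++ f []       ys = refl
∑-++ f (x ∷ xs) ys = trans (cong (f x +_) (∑-++ f xs ys)) (sym (+-assoc (f x) _ _))

∑-map : (f : B → ℕ) (g : A → B) (xs : List A) → ∑ (map g xs) f ≡ ∑ xs (f ∘ g)
∑-map f g xs = cong sum (sym (map-∘ xs))

∑-concatMap : (f : B → ℕ) (g : A → List B) (xs : List A) →
              ∑ (concatMap g xs) f ≡ ∑ xs (λ x → ∑ (g x) f)
∑-concatMap f g []       = refl
∑-concatMap f g (x ∷ xs) =
  trans (∑-++ f (g x) (concatMap g xs)) (cong (∑ (g x) f +_) (∑-concatMap f g xs))

∑-*ˡ : (k : ℕ) (f : A → ℕ) (xs : List A) → ∑ xs (λ x → k * f x) ≡ k * ∑ xs f
∑-*ˡ k f []       = sym (*-zeroʳ k)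
∑-*ˡ k f (x ∷ xs) = trans (cong (k * f x +_) (∑-*ˡ k f xs)) (sym (*-distribˡ-+ k (f x) _))

∑-indicator : (p : A → Bool) (a : ℕ) (xs : List A) →
              ∑ xs (λ x → if p x then a else 0) ≡ countᵇ p xs * a
∑-indicator p a []       = refl
∑-indicator p a (x ∷ xs) with p x
... | true  = cong (a +_) (∑-indicator p a xs)
... | false = ∑-indicator p a xs

∏-if : (p : A → Bool) (k : ℕ) (f : A → ℕ) (xs : List A) →
       ∏ xs (λ x → if p x then k * f x else f x) ≡ k ^ countᵇ p xs * ∏ xs f
∏-if p k f []       = refl
∏-if p k f (x ∷ xs) with p x
... | true  = trans (cong (k * f x *_) (∏-if p k f xs)) (*-interchange k (f x) _ _)
... | false = trans (cong (f x *_) (∏-if p k f xs)) (x∙yz≈y∙xz (f x) (k ^ countᵇ p xs) (∏ xs f))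

∑-allFin-suc : ∀ {n} (f : Fin (suc n) → ℕ) → ∑ (allFin (suc n)) f ≡ f zero + ∑ (allFin n) (f ∘ suc)
∑-allFin-suc f = cong (λ ys → f zero + sum ys) (trans (map-tabulate suc f) (sym (map-tabulate (λ i → i) (f ∘ suc))))

∏-ones : (xs : List A) → ∏ xs (λ _ → 1) ≡ 1
∏-ones []       = refl
∏-ones (x ∷ xs) = trans (+-identityʳ _) (∏-ones xs)

∑-concatMap-map : {B : A → Set} {C : Set}
                  (f : C → ℕ) (g : ∀ x → B x → C) (ys : ∀ x → List (B x)) (xs : List A) →
                  ∑ (concatMap (λ x → map (g x) (ys x)) xs) f ≡ ∑ xs (λ x → ∑ (ys x) (f ∘ g x))
∑-concatMap-map f g ys xs = trans (∑-concatMap f _ xs) (∑-cong (λ x → ∑-map f (g x) (ys x)) xs)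

∑-allFin-lookup : ∀ {L} (f : A → ℕ) (w : Vec A L) → ∑ (allFin L) (f ∘ lookup w) ≡ ∑ (toList w) f
∑-allFin-lookup f []      = refl
∑-allFin-lookup f (c ∷ w) = trans (∑-allFin-suc (f ∘ lookup (c ∷ w))) (cong (f c +_) (∑-allFin-lookup f w))

module _ {p q : A → Bool} where

  countᵇ-cong : (∀ x → p x ≡ q x) → ∀ xs → countᵇ p xs ≡ countᵇ q xs
  countᵇ-cong p≗q = ∑-cong (λ x → cong (λ b → if b then 1 else 0) (p≗q x))

  countᵇ-∨ : (∀ x → (p x ∧ q x) ≡ false) → ∀ xs →
             countᵇ (λ x → p x ∨ q x) xs ≡ countᵇ p xs + countᵇ q xs
  countᵇ-∨ disjoint []       = refl
  countᵇ-∨ disjoint (x ∷ xs) with p x | q x | disjoint x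
  ... | true  | false | _ = cong suc (countᵇ-∨ disjoint xs)
  ... | false | true  | _ = trans (cong suc (countᵇ-∨ disjoint xs)) (sym (+-suc _ _))
  ... | false | false | _ = countᵇ-∨ disjoint xs

  countᵇ-filterᵇ : ∀ xs → countᵇ p (filterᵇ q xs) ≡ countᵇ (λ x → q x ∧ p x) xs
  countᵇ-filterᵇ []       = refl
  countᵇ-filterᵇ (x ∷ xs) with q x
  ... | true  = cong (_ +_) (countᵇ-filterᵇ xs)
  ... | false = countᵇ-filterᵇ xs

module _ {p : A → Bool} where

  countᵇ-none : (∀ x → p x ≡ false) → ∀ xs → countᵇ p xs ≡ 0
  countᵇ-none none []       = refl
  countᵇ-none none (x ∷ xs) rewrite none x = countᵇ-none none xs

  countᵇ-all : (∀ x → p x ≡ true) → ∀ xs → countᵇ p xs ≡ length xs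
  countᵇ-all every []       = refl
  countᵇ-all every (x ∷ xs) rewrite every x = cong suc (countᵇ-all every xs)

  countᵇ≤length : ∀ xs → countᵇ p xs ≤ length xs
  countᵇ≤length []       = z≤n
  countᵇ≤length (x ∷ xs) with p x
  ... | true  = s≤s (countᵇ≤length xs)
  ... | false = m≤n⇒m≤1+n (countᵇ≤length xs)

  length-filterᵇ : ∀ xs → length (filterᵇ p xs) ≡ countᵇ p xs
  length-filterᵇ []       = refl
  length-filterᵇ (x ∷ xs) with p x
  ... | true  = cong suc (length-filterᵇ xs)
  ... | false = length-filterᵇ xs

  length≡countᵇ+countᵇ-not : ∀ xs → length xs ≡ countᵇ p xs + countᵇ (not ∘ p) xs
  length≡countᵇ+countᵇ-not []       = refl
  length≡countᵇ+countᵇ-not (x ∷ xs) with p x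
  ... | true  = cong suc (length≡countᵇ+countᵇ-not xs)
  ... | false = trans (cong suc (length≡countᵇ+countᵇ-not xs)) (sym (+-suc _ _))

-- Lists enumerating a type

record Enumerates (_≟_ : DecidableEquality A) (xs : List A) : Set where
  constructor listing
  field
    listed-once : ∀ x → countᵇ (λ y → ⌊ x ≟ y ⌋) xs ≡ 1

open Enumerates

allFin-enumerates : ∀ m → Enumerates Fin._≟_ (allFin m)
allFin-enumerates m = listing (listed m)
  where
    listed : ∀ m (i : Fin m) → countᵇ (λ j → ⌊ i Fin.≟ j ⌋) (allFin m) ≡ 1
    listed (suc m) i = trans (∑-allFin-suc (λ j → if ⌊ i Fin.≟ j ⌋ then 1 else 0)) (go i)
      where go : ∀ i → (if ⌊ i Fin.≟ zero ⌋ then 1 else 0) + countᵇ (λ j → ⌊ i Fin.≟ suc j ⌋) (allFin m) ≡ 1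
            go zero    = cong suc (countᵇ-none (λ _ → refl) (allFin m))
            go (suc i) = trans (countᵇ-cong (λ j → ⌊⌋-map′ _ _ (i Fin.≟ j)) (allFin m)) (listed m i)

module _ {B : A → Set} (_≟A_ : DecidableEquality A) (_≟B_ : ∀ {a} → DecidableEquality (B a)) where

  concatMap-enumerates : ∀ {xs} {ys : ∀ a → List (B a)} →
                         Enumerates _≟A_ xs → (∀ a → Enumerates _≟B_ (ys a)) →
                         Enumerates (Σ-≡-dec _≟A_ _≟B_) (concatMap (λ a → map (a ,_) (ys a)) xs)
  concatMap-enumerates {xs} {ys} xs-enum ys-enum = listing listed
    where
      is : Σ A B → Σ A B → Bool
      is u v = ⌊ Σ-≡-dec _≟A_ _≟B_ u v ⌋
      listed : ∀ ab → countᵇ (is ab) (concatMap (λ a → map (a ,_) (ys a)) xs) ≡ 1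
      listed (a , b) = begin
        countᵇ (is (a , b)) (concatMap (λ a′ → map (a′ ,_) (ys a′)) xs)  ≡⟨ ∑-concatMap _ _ xs ⟩
        ∑ xs (λ a′ → countᵇ (is (a , b)) (map (a′ ,_) (ys a′)))          ≡⟨ ∑-cong fibre xs ⟩
        countᵇ (λ a′ → ⌊ a ≟A a′ ⌋) xs                                   ≡⟨ listed-once xs-enum a ⟩
        1                                                                 ∎
        where
          open ≡-Reasoning
          fibre : ∀ a′ → countᵇ (is (a , b)) (map (a′ ,_) (ys a′)) ≡ (if ⌊ a ≟A a′ ⌋ then 1 else 0)
          fibre a′ with a ≟A a′
          ... | yes refl = trans (∑-map _ _ (ys a))
                                 (trans (countᵇ-cong (λ b′ → ⌊⌋-⇔ (λ { refl → refl }) (cong (a ,_)) _ (b ≟B b′)) (ys a))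
                                        (listed-once (ys-enum a) b))
          ... | no  a≢a′ = trans (∑-map _ _ (ys a′))
                                 (countᵇ-none (λ b′ → ⌊⌋-false (Σ-≡-dec _≟A_ _≟B_ _ _) (a≢a′ ∘ cong proj₁)) (ys a′))

allVec-enumerates : ∀ {_≟_ : DecidableEquality A} {xs} →
                    Enumerates _≟_ xs → ∀ L → Enumerates (Vec-≡-dec _≟_) (allVec xs L)
allVec-enumerates                  xs-enum zero    = listing λ { [] → refl }
allVec-enumerates {_≟_ = _≟_} {xs} xs-enum (suc L) = listing listed
  where
    is : ∀ {L} → Vec _ L → Vec _ L → Bool
    is u v = ⌊ Vec-≡-dec _≟_ u v ⌋
    listed : ∀ v → countᵇ (is v) (allVec xs (suc L)) ≡ 1
    listed (a ∷ u) = begin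
      countᵇ (is (a ∷ u)) (concatMap (λ x → map (x ∷_) (allVec xs L)) xs) ≡⟨ ∑-concatMap _ _ xs ⟩
      ∑ xs (λ x → countᵇ (is (a ∷ u)) (map (x ∷_) (allVec xs L)))        ≡⟨ ∑-cong fibre xs ⟩
      countᵇ (λ x → ⌊ a ≟ x ⌋) xs                                         ≡⟨ listed-once xs-enum a ⟩
      1                                                                    ∎
      where
        open ≡-Reasoning
        fibre : ∀ x → countᵇ (is (a ∷ u)) (map (x ∷_) (allVec xs L)) ≡ (if ⌊ a ≟ x ⌋ then 1 else 0)
        fibre x with a ≟ x
        ... | yes refl = trans (∑-map _ _ (allVec xs L))
                         (trans (countᵇ-cong (λ v → ⌊⌋-⇔ ∷-injectiveʳ (cong (a ∷_)) _ (Vec-≡-dec _≟_ u v)) (allVec xs L))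
                                (listed-once (allVec-enumerates xs-enum L) u))
        ... | no  a≢x  = trans (∑-map _ _ (allVec xs L))
                         (countᵇ-none (λ v → ⌊⌋-false (Vec-≡-dec _≟_ _ _) (a≢x ∘ ∷-injectiveˡ)) (allVec xs L))

filterᵇ-enumerates : ∀ {_≟_ : DecidableEquality A} {p xs} → Enumerates _≟_ xs →
                     ∀ u → T (p u) → countᵇ (λ y → ⌊ u ≟ y ⌋) (filterᵇ p xs) ≡ 1
filterᵇ-enumerates {_≟_ = _≟_} {p} {xs} xs-enum u pu =
  trans (countᵇ-filterᵇ xs) (trans (countᵇ-cong only-u xs) (listed-once xs-enum u))
  where
    only-u : ∀ y → (p y ∧ ⌊ u ≟ y ⌋) ≡ ⌊ u ≟ y ⌋
    only-u y = T-injective (proj₂ ∘ to T-∧) (λ u≡y → from T-∧ (subst (T ∘ p) (toWitness u≡y) pu , u≡y))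

countᵇ-remove : ∀ {_≟_ : DecidableEquality A} {xs} → Enumerates _≟_ xs →
                ∀ {p} x → T (p x) → countᵇ p xs ≡ suc (countᵇ (λ y → not ⌊ x ≟ y ⌋ ∧ p y) xs)
countᵇ-remove {_≟_ = _≟_} {xs} xs-enum {p} x px = begin
  countᵇ p xs                                                    ≡⟨ countᵇ-cong split xs ⟩
  countᵇ (λ y → ⌊ x ≟ y ⌋ ∨ (not ⌊ x ≟ y ⌋ ∧ p y)) xs            ≡⟨ countᵇ-∨ disjoint xs ⟩
  countᵇ (λ y → ⌊ x ≟ y ⌋) xs + rest                            ≡⟨ cong (_+ rest) (listed-once xs-enum x) ⟩
  suc rest                                                       ∎
  where
    open ≡-Reasoning
    rest = countᵇ (λ y → not ⌊ x ≟ y ⌋ ∧ p y) xs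
    split : ∀ y → p y ≡ (⌊ x ≟ y ⌋ ∨ (not ⌊ x ≟ y ⌋ ∧ p y))
    split y with x ≟ y
    ... | yes refl = to T-≡ px
    ... | no  _    = refl
    disjoint : ∀ y → (⌊ x ≟ y ⌋ ∧ (not ⌊ x ≟ y ⌋ ∧ p y)) ≡ false
    disjoint y with ⌊ x ≟ y ⌋
    ... | true  = refl
    ... | false = refl

module _ {_≟_ : DecidableEquality A} (f : B → A) (f-injective : Injective _≡_ _≡_ f) where

  countᵇ-image : ∀ {S} → Unique S → ∀ ys → (∀ s → countᵇ (λ y → ⌊ f s ≟ y ⌋) ys ≡ 1) →
                 countᵇ (λ y → any (λ s → ⌊ f s ≟ y ⌋) S) ys ≡ length S
  countᵇ-image []                 ys once = countᵇ-none (λ _ → refl) ys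
  countᵇ-image {s ∷ S} (s∉S ∷ S-unique) ys once =
    trans (countᵇ-∨ disjoint ys) (cong₂ _+_ (once s) (countᵇ-image S-unique ys once))
    where
      disjoint : ∀ y → (⌊ f s ≟ y ⌋ ∧ any (λ t → ⌊ f t ≟ y ⌋) S) ≡ false
      disjoint y = ¬T⇒≡false λ both →
        let fs≡y , hit = to T-∧ both
            s≢t , ft≡y = All.lookupAny s∉S (any⁻ _ S hit)
        in s≢t (f-injective (trans (toWitness fs≡y) (sym (toWitness ft≡y))))

-- Counting equivalence classes

module _ (r : A → A → Bool) (r-equiv : IsEquivalence (λ x y → T (r x y))) where

  open IsEquivalence r-equiv renaming (refl to r-refl; sym to r-sym; trans to r-trans)

  classes-remove : ∀ a xs → classes r xs ≡ classes r (filterᵇ (not ∘ r a) xs) + (if any (r a) xs then 1 else 0)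
  classes-remove a []       = refl
  classes-remove a (y ∷ ys) with r a y in ay
  ... | true  = begin
    (if any (r y) ys then classes r ys else suc (classes r ys))
      ≡⟨ cong (λ b → if b then classes r ys else suc (classes r ys)) y∼a ⟩
    (if any (r a) ys then classes r ys else suc (classes r ys))
      ≡⟨ cong (λ c → if any (r a) ys then c else suc c) (classes-remove a ys) ⟩
    (if any (r a) ys then rest + ι (any (r a) ys) else suc (rest + ι (any (r a) ys)))
      ≡⟨ either (any (r a) ys) ⟩
    rest + 1 ∎
    where
      open ≡-Reasoning
      rest = classes r (filterᵇ (not ∘ r a) ys)
      y∼a : any (r y) ys ≡ any (r a) ys
      y∼a = any-cong (λ _ → r-trans (from T-≡ ay)) (λ _ → r-trans (r-sym (from T-≡ ay))) ys
      ι : Bool → ℕ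
      ι b = if b then 1 else 0
      either : ∀ b → (if b then rest + ι b else suc (rest + ι b)) ≡ rest + 1
      either true  = refl
      either false = sym (+-suc rest 0)
  ... | false = begin
    (if any (r y) ys then classes r ys else suc (classes r ys))
      ≡⟨ cong (λ b → if b then classes r ys else suc (classes r ys)) (sym y∼ys′) ⟩
    (if any (r y) ys′ then classes r ys else suc (classes r ys))
      ≡⟨ cong (λ c → if any (r y) ys′ then c else suc c) (classes-remove a ys) ⟩
    (if any (r y) ys′ then classes r ys′ + a∈ys else suc (classes r ys′) + a∈ys)
      ≡⟨ if-float (_+ a∈ys) (any (r y) ys′) ⟨
    (if any (r y) ys′ then classes r ys′ else suc (classes r ys′)) + a∈ys ∎
    where
      open ≡-Reasoning
      ys′ = filterᵇ (not ∘ r a) ys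
      a∈ys = if any (r a) ys then 1 else 0
      y∼ys′ : any (r y) ys′ ≡ any (r y) ys
      y∼ys′ = any-filterᵇ (λ z yz → ¬T⇒T-not (λ az → subst T ay (r-trans az (r-sym yz)))) ys

  length≡*classes : ∀ k xs → All (λ x → countᵇ (r x) xs ≡ k) xs → length xs ≡ k * classes r xs
  length≡*classes k xs = go (length xs) xs ≤-refl
    where
      -- Removing the class of the head does not leave a structural sublist, hence the fuel.
      go : ∀ fuel xs → length xs ≤ fuel → All (λ x → countᵇ (r x) xs ≡ k) xs → length xs ≡ k * classes r xs
      go _          []         _          []               = sym (*-zeroʳ k)
      go (suc fuel) xs@(a ∷ t) (s≤s t≤fuel) regular@(ka ∷ _) = begin
        length xs                                ≡⟨ length≡countᵇ+countᵇ-not {p = r a} xs ⟩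
        countᵇ (r a) xs + countᵇ (not ∘ r a) xs  ≡⟨ cong₂ _+_ ka (sym (length-filterᵇ xs)) ⟩
        k + length xs′                           ≡⟨ cong (k +_) (go fuel xs′ shorter regular′) ⟩
        k + k * classes r xs′                    ≡⟨ *-suc k _ ⟨
        k * suc (classes r xs′)                  ≡⟨ cong (k *_) (+-comm 1 _) ⟩
        k * (classes r xs′ + 1)                  ≡⟨ cong (λ b → k * (classes r xs′ + (if b ∨ any (r a) t then 1 else 0)))
                                                         (to T-≡ r-refl) ⟨
        k * (classes r xs′ + (if any (r a) xs then 1 else 0)) ≡⟨ cong (k *_) (classes-remove a xs) ⟨
        k * classes r xs                         ∎
        where
          open ≡-Reasoning
          xs′ = filterᵇ (not ∘ r a) xs
          a∉xs′ : ∀ b → T b → (if not b then 1 else 0) + countᵇ (not ∘ r a) t ≤ fuel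
          a∉xs′ true _ = ≤-trans (countᵇ≤length t) t≤fuel
          shorter : length xs′ ≤ fuel
          shorter = ≤-trans (≤-reflexive (length-filterᵇ xs)) (a∉xs′ (r a a) r-refl)
          same-count : ∀ {x} → T (not (r a x)) → ∀ z → (not (r a z) ∧ r x z) ≡ r x z
          same-count ¬ax z = T-injective (proj₂ ∘ to T-∧)
            (λ xz → from T-∧ (¬T⇒T-not (λ az → T-not⇒¬T ¬ax (r-trans az (r-sym xz))) , xz))
          regular′ : All (λ x → countᵇ (r x) xs′ ≡ k) xs′
          regular′ = All.zipWith
            (λ {x} (kx , ¬ax) → trans (countᵇ-filterᵇ {p = r x} {q = not ∘ r a} xs)
                                      (trans (countᵇ-cong (same-count ¬ax) xs) kx))
            (filter⁺ (T? ∘ not ∘ r a) regular , all-filter (T? ∘ not ∘ r a) xs)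

-- k-permutations

P-suc : ∀ a k → a P suc k ≡ a * (pred a P k)
P-suc zero    k       = refl
P-suc (suc a) zero    = refl
P-suc (suc a) (suc k) with k <ᵇ a
... | true  = nP′k≡n[n∸1P′k∸1] (suc a) (suc (suc k))
... | false = sym (*-zeroʳ (suc a))

module _ {a c : A → ℕ} where

  ∏-P≡0 : ∀ xs → ∑ xs a < ∑ xs c → ∏ xs (λ i → a i P c i) ≡ 0
  ∏-P≡0 (x ∷ xs) lt with a x <? c x
  ... | yes ax<cx = cong (_* _) (k>n⇒nPk≡0 ax<cx)
  ... | no  ax≮cx = trans (cong ((a x P c x) *_) (∏-P≡0 xs rest<)) (*-zeroʳ (a x P c x))
    where rest< : ∑ xs a < ∑ xs c
          rest< = ≰⇒> (λ c≤a → <⇒≱ lt (+-mono-≤ (≮⇒≥ ax≮cx) c≤a))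

  -- With equal sums, either c = a pointwise or some c i > a i, making a factor vanish.
  ∏-P : ∀ xs → ∑ xs c ≡ ∑ xs a →
        ∏ xs (λ i → a i P c i) ≡ (if all (λ i → c i ≡ᵇ a i) xs then ∏ xs (λ i → a i !) else 0)
  ∏-P []       _  = refl
  ∏-P (x ∷ xs) eq with c x ≡ᵇ a x in cx≡ᵇax
  ... | true  = begin
    (a x P c x) * ∏ xs (λ i → a i P c i)
      ≡⟨ cong₂ _*_ (trans (cong (a x P_) cx≡ax) (nPn≡n! (a x))) (∏-P xs rest≡) ⟩
    a x ! * (if allEqual then ∏ xs (λ i → a i !) else 0)
      ≡⟨ if-float (a x ! *_) allEqual ⟩
    (if allEqual then a x ! * ∏ xs (λ i → a i !) else a x ! * 0)
      ≡⟨ if-cong-else allEqual (*-zeroʳ (a x !)) ⟩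
    (if allEqual then a x ! * ∏ xs (λ i → a i !) else 0) ∎
    where
      open ≡-Reasoning
      allEqual = all (λ i → c i ≡ᵇ a i) xs
      cx≡ax : c x ≡ a x
      cx≡ax = ≡ᵇ⇒≡ (c x) (a x) (from T-≡ cx≡ᵇax)
      rest≡ : ∑ xs c ≡ ∑ xs a
      rest≡ = +-cancelˡ-≡ (a x) _ _ (trans (cong (_+ ∑ xs c) (sym cx≡ax)) eq)
  ∏-P (x ∷ xs) eq | false with <-cmp (c x) (a x)
  ... | tri< cx<ax _ _ = trans (cong ((a x P c x) *_) (∏-P≡0 xs rest<)) (*-zeroʳ (a x P c x))
    where rest< : ∑ xs a < ∑ xs c
          rest< = ≰⇒> (λ c≤a → <-irrefl eq (+-mono-<-≤ cx<ax c≤a))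
  ... | tri≈ _ cx≡ax _ = ⊥-elim (subst T cx≡ᵇax (≡⇒≡ᵇ (c x) (a x) cx≡ax))
  ... | tri> _ _ ax<cx = cong (_* _) (k>n⇒nPk≡0 ax<cx)

-- Arithmetic modulo N on Fin N

[m%d+n]%d≡[m+n]%d : ∀ m n d .{{_ : NonZero d}} → (m % d + n) % d ≡ (m + n) % d
[m%d+n]%d≡[m+n]%d m n d = begin
  (m % d + n) % d          ≡⟨ %-distribˡ-+ (m % d) n d ⟩
  (m % d % d + n % d) % d  ≡⟨ cong (λ x → (x + n % d) % d) (m%n%n≡m%n m d) ⟩
  (m % d + n % d) % d      ≡⟨ %-distribˡ-+ m n d ⟨
  (m + n) % d              ∎
  where open ≡-Reasoning

[m+n%d]%d≡[m+n]%d : ∀ m n d .{{_ : NonZero d}} → (m + n % d) % d ≡ (m + n) % d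
[m+n%d]%d≡[m+n]%d m n d = begin
  (m + n % d) % d  ≡⟨ cong (_% d) (+-comm m (n % d)) ⟩
  (n % d + m) % d  ≡⟨ [m%d+n]%d≡[m+n]%d n m d ⟩
  (n + m) % d      ≡⟨ cong (_% d) (+-comm n m) ⟩
  (m + n) % d      ∎
  where open ≡-Reasoning

module _ {k : ℕ} where

  private
    N = suc k

  toℕ-shift : (s p : Fin N) → toℕ (shift s p) ≡ (toℕ p + toℕ s) % N
  toℕ-shift s p = toℕ-fromℕ< _

  toℕ-cnext : (p : Fin N) → toℕ (cnext p) ≡ suc (toℕ p) % N
  toℕ-cnext p = toℕ-fromℕ< _

  negate : Fin N → Fin N
  negate s = (N ∸ toℕ s) mod N

  shift-by-zero : (p : Fin N) → shift zero p ≡ p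
  shift-by-zero p = toℕ-injective (begin
    toℕ (shift zero p)  ≡⟨ toℕ-shift zero p ⟩
    (toℕ p + 0) % N     ≡⟨ cong (_% N) (+-identityʳ (toℕ p)) ⟩
    toℕ p % N           ≡⟨ m<n⇒m%n≡m (toℕ<n p) ⟩
    toℕ p               ∎)
    where open ≡-Reasoning

  shift-comm : (s t : Fin N) → shift s t ≡ shift t s
  shift-comm s t = toℕ-injective (begin
    toℕ (shift s t)      ≡⟨ toℕ-shift s t ⟩
    (toℕ t + toℕ s) % N  ≡⟨ cong (_% N) (+-comm (toℕ t) (toℕ s)) ⟩
    (toℕ s + toℕ t) % N  ≡⟨ toℕ-shift t s ⟨
    toℕ (shift t s)      ∎)
    where open ≡-Reasoning

  shift-shift : (s t p : Fin N) → shift t (shift s p) ≡ shift (shift t s) p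
  shift-shift s t p = toℕ-injective (begin
    toℕ (shift t (shift s p))            ≡⟨ toℕ-shift t (shift s p) ⟩
    (toℕ (shift s p) + toℕ t) % N        ≡⟨ cong (λ x → (x + toℕ t) % N) (toℕ-shift s p) ⟩
    ((toℕ p + toℕ s) % N + toℕ t) % N    ≡⟨ [m%d+n]%d≡[m+n]%d (toℕ p + toℕ s) (toℕ t) N ⟩
    (toℕ p + toℕ s + toℕ t) % N          ≡⟨ cong (_% N) (+-assoc (toℕ p) (toℕ s) (toℕ t)) ⟩
    (toℕ p + (toℕ s + toℕ t)) % N        ≡⟨ [m+n%d]%d≡[m+n]%d (toℕ p) (toℕ s + toℕ t) N ⟨
    (toℕ p + (toℕ s + toℕ t) % N) % N    ≡⟨ cong (λ x → (toℕ p + x) % N) (toℕ-shift t s) ⟨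
    (toℕ p + toℕ (shift t s)) % N        ≡⟨ toℕ-shift (shift t s) p ⟨
    toℕ (shift (shift t s) p)            ∎)
    where open ≡-Reasoning

  [s+negate[s]]%N≡0 : (s : Fin N) → (toℕ s + toℕ (negate s)) % N ≡ 0
  [s+negate[s]]%N≡0 s = begin
    (toℕ s + toℕ (negate s)) % N    ≡⟨ cong (λ x → (toℕ s + x) % N) (toℕ-fromℕ< _) ⟩
    (toℕ s + (N ∸ toℕ s) % N) % N   ≡⟨ [m+n%d]%d≡[m+n]%d (toℕ s) (N ∸ toℕ s) N ⟩
    (toℕ s + (N ∸ toℕ s)) % N       ≡⟨ cong (_% N) (m+[n∸m]≡n (<⇒≤ (toℕ<n s))) ⟩
    N % N                           ≡⟨ n%n≡0 N ⟩
    0                               ∎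
    where open ≡-Reasoning

  shift-negate : (s : Fin N) → shift (negate s) s ≡ zero
  shift-negate s = toℕ-injective (trans (toℕ-shift (negate s) s) ([s+negate[s]]%N≡0 s))

  shift-injective : (s : Fin N) → Injective _≡_ _≡_ (shift s)
  shift-injective s {p} {q} sp≡sq = begin
    p                                 ≡⟨ unshift p ⟨
    shift (negate s) (shift s p)      ≡⟨ cong (shift (negate s)) sp≡sq ⟩
    shift (negate s) (shift s q)      ≡⟨ unshift q ⟩
    q                                 ∎
    where
      open ≡-Reasoning
      unshift : ∀ x → shift (negate s) (shift s x) ≡ x
      unshift x = trans (shift-shift s (negate s) x) (trans (cong (λ t → shift t x) (shift-negate s)) (shift-by-zero x))

  shift-of-zero : (s : Fin N) → shift s zero ≡ s
  shift-of-zero s = trans (shift-comm s zero) (shift-by-zero s)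

  cnext-shift : (s p : Fin N) → cnext (shift s p) ≡ shift s (cnext p)
  cnext-shift s p = toℕ-injective (begin
    toℕ (cnext (shift s p))          ≡⟨ toℕ-cnext (shift s p) ⟩
    suc (toℕ (shift s p)) % N        ≡⟨ cong (λ x → suc x % N) (toℕ-shift s p) ⟩
    (1 + (toℕ p + toℕ s) % N) % N    ≡⟨ [m+n%d]%d≡[m+n]%d 1 (toℕ p + toℕ s) N ⟩
    (suc (toℕ p) + toℕ s) % N        ≡⟨ [m%d+n]%d≡[m+n]%d (suc (toℕ p)) (toℕ s) N ⟨
    (suc (toℕ p) % N + toℕ s) % N    ≡⟨ cong (λ x → (x + toℕ s) % N) (toℕ-cnext p) ⟨
    (toℕ (cnext p) + toℕ s) % N      ≡⟨ toℕ-shift s (cnext p) ⟨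
    toℕ (shift s (cnext p))          ∎)
    where open ≡-Reasoning

  -- opposite y is −1 − y modulo N.
  opposite-unique : (x y : Fin N) → (toℕ x + suc (toℕ y)) % N ≡ 0 → x ≡ opposite y
  opposite-unique x y u%N≡0 = toℕ-injective (begin
    toℕ x                ≡⟨ m+n∸n≡m (toℕ x) (suc (toℕ y)) ⟨
    u ∸ suc (toℕ y)      ≡⟨ cong (_∸ suc (toℕ y)) u≡N ⟩
    N ∸ suc (toℕ y)      ≡⟨ opposite-prop y ⟨
    toℕ (opposite y)     ∎)
    where
      open ≡-Reasoning
      u = toℕ x + suc (toℕ y)
      u≡N : u ≡ N
      u≡N with N ≤? u
      ... | yes N≤u = ≤-antisym (m∸n≡0⇒m≤n (begin
              u ∸ N        ≡⟨ m<n⇒m%n≡m (m<n+o⇒m∸n<o u N (+-mono-<-≤ (toℕ<n x) (toℕ<n y))) ⟨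
              (u ∸ N) % N  ≡⟨ m≤n⇒[n∸m]%m≡n%m N≤u ⟩
              u % N        ≡⟨ u%N≡0 ⟩
              0            ∎)) N≤u
      ... | no  N≰u = contradiction (trans (sym (m<n⇒m%n≡m (≰⇒> N≰u))) u%N≡0) (m+1+n≢0 (toℕ x))

  toℕ-opposite+suc : (p : Fin N) → toℕ (opposite p) + suc (toℕ p) ≡ N
  toℕ-opposite+suc p = trans (cong (_+ suc (toℕ p)) (opposite-prop p)) (m∸n+n≡m (toℕ<n p))

  shift-opposite : (s p : Fin N) → shift s (opposite p) ≡ opposite (shift (negate s) p)
  shift-opposite s p = opposite-unique (shift s (opposite p)) (shift (negate s) p) (begin
    (toℕ (shift s (opposite p)) + suc (toℕ (shift (negate s) p))) % N
      ≡⟨ cong₂ (λ x y → (x + suc y) % N) (toℕ-shift s (opposite p)) (toℕ-shift (negate s) p) ⟩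
    ((o + toℕ s) % N + suc ((toℕ p + n) % N)) % N
      ≡⟨ [m%d+n]%d≡[m+n]%d (o + toℕ s) _ N ⟩
    (o + toℕ s + suc ((toℕ p + n) % N)) % N
      ≡⟨ cong (_% N) (+-suc (o + toℕ s) _) ⟩
    (suc (o + toℕ s) + (toℕ p + n) % N) % N
      ≡⟨ [m+n%d]%d≡[m+n]%d (suc (o + toℕ s)) (toℕ p + n) N ⟩
    (suc (o + toℕ s) + (toℕ p + n)) % N
      ≡⟨ cong (_% N) (regroup o (toℕ s) (toℕ p) n) ⟩
    (o + suc (toℕ p) + (toℕ s + n)) % N
      ≡⟨ cong (λ x → (x + (toℕ s + n)) % N) (toℕ-opposite+suc p) ⟩
    (N + (toℕ s + n)) % N
      ≡⟨ cong (_% N) (+-comm N _) ⟩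
    (toℕ s + n + N) % N
      ≡⟨ [m+n]%n≡m%n (toℕ s + n) N ⟩
    (toℕ s + n) % N
      ≡⟨ [s+negate[s]]%N≡0 s ⟩
    0 ∎)
    where
      open ≡-Reasoning
      o = toℕ (opposite p)
      n = toℕ (negate s)
      regroup : ∀ o s p n → suc (o + s) + (p + n) ≡ o + suc p + (s + n)
      regroup = solve-∀

  cnext-opposite : (p : Fin N) → cnext (opposite (cnext p)) ≡ opposite p
  cnext-opposite p = opposite-unique (cnext (opposite (cnext p))) p (begin
    (toℕ (cnext (opposite (cnext p))) + suc (toℕ p)) % N
      ≡⟨ cong (λ x → (x + suc (toℕ p)) % N) (toℕ-cnext (opposite (cnext p))) ⟩
    (suc o % N + suc (toℕ p)) % N
      ≡⟨ [m%d+n]%d≡[m+n]%d (suc o) (suc (toℕ p)) N ⟩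
    (suc o + suc (toℕ p)) % N
      ≡⟨ [m+n%d]%d≡[m+n]%d (suc o) (suc (toℕ p)) N ⟨
    (suc o + suc (toℕ p) % N) % N
      ≡⟨ cong (λ x → (suc o + x) % N) (toℕ-cnext p) ⟨
    (suc o + toℕ (cnext p)) % N
      ≡⟨ cong (_% N) (+-suc o (toℕ (cnext p))) ⟨
    (o + suc (toℕ (cnext p))) % N
      ≡⟨ cong (_% N) (toℕ-opposite+suc (cnext p)) ⟩
    N % N
      ≡⟨ n%n≡0 N ⟩
    0 ∎)
    where
      open ≡-Reasoning
      o = toℕ (opposite (cnext p))

-- Rotation and reversal of vectors

lookup-ext : ∀ {n} (u v : Vec A n) → (∀ p → lookup u p ≡ lookup v p) → u ≡ v
lookup-ext u v u≗v = trans (sym (tabulate∘lookup u)) (trans (tabulate-cong u≗v) (tabulate∘lookup v))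

lookup-∷ʳ-last : ∀ {n} (ys : Vec A n) (x : A) → lookup (ys ∷ʳ x) (fromℕ n) ≡ x
lookup-∷ʳ-last []       x = refl
lookup-∷ʳ-last (y ∷ ys) x = lookup-∷ʳ-last ys x

lookup-∷ʳ-inject₁ : ∀ {n} (ys : Vec A n) (x : A) (i : Fin n) → lookup (ys ∷ʳ x) (inject₁ i) ≡ lookup ys i
lookup-∷ʳ-inject₁ (y ∷ ys) x zero    = refl
lookup-∷ʳ-inject₁ (y ∷ ys) x (suc i) = lookup-∷ʳ-inject₁ ys x i

lookup-reverse-opposite : ∀ {n} (v : Vec A n) (i : Fin n) → lookup (reverse v) (opposite i) ≡ lookup v i
lookup-reverse-opposite {n = suc n} (x ∷ xs) zero =
  trans (cong (λ u → lookup u (fromℕ n)) (reverse-∷ x xs)) (lookup-∷ʳ-last (reverse xs) x)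
lookup-reverse-opposite (x ∷ xs) (suc i) =
  trans (cong (λ u → lookup u (inject₁ (opposite i))) (reverse-∷ x xs))
        (trans (lookup-∷ʳ-inject₁ (reverse xs) x (opposite i)) (lookup-reverse-opposite xs i))

lookup-reverse : ∀ {n} (v : Vec A n) (p : Fin n) → lookup (reverse v) p ≡ lookup v (opposite p)
lookup-reverse v p = trans (cong (lookup (reverse v)) (sym (opposite-involutive p))) (lookup-reverse-opposite v (opposite p))

module _ {A : Set} {k : ℕ} where

  private
    N = suc k

  lookup-rotate : (s : Fin N) (v : Vec A N) (p : Fin N) → lookup (rotate s v) p ≡ lookup v (shift s p)
  lookup-rotate s v = lookup∘tabulate (lookup v ∘ shift s)

  rotate-zero : (v : Vec A N) → rotate zero v ≡ v
  rotate-zero v = trans (tabulate-cong (cong (lookup v) ∘ shift-by-zero)) (tabulate∘lookup v)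

  rotate-rotate : (s t : Fin N) (v : Vec A N) → rotate s (rotate t v) ≡ rotate (shift t s) v
  rotate-rotate s t v = tabulate-cong λ p → trans (lookup-rotate t v (shift s p)) (cong (lookup v) (shift-shift s t p))

  rotate-negate : (s : Fin N) (v : Vec A N) → rotate (negate s) (rotate s v) ≡ v
  rotate-negate s v = begin
    rotate (negate s) (rotate s v)  ≡⟨ rotate-rotate (negate s) s v ⟩
    rotate (shift s (negate s)) v   ≡⟨ cong (λ t → rotate t v) (trans (shift-comm s (negate s)) (shift-negate s)) ⟩
    rotate zero v                   ≡⟨ rotate-zero v ⟩
    v                               ∎
    where open ≡-Reasoning

  reverse-rotate : (s : Fin N) (v : Vec A N) → reverse (rotate s v) ≡ rotate (negate s) (reverse v)
  reverse-rotate s v = lookup-ext _ _ λ p → begin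
    lookup (reverse (rotate s v)) p           ≡⟨ lookup-reverse (rotate s v) p ⟩
    lookup (rotate s v) (opposite p)          ≡⟨ lookup-rotate s v (opposite p) ⟩
    lookup v (shift s (opposite p))           ≡⟨ cong (lookup v) (shift-opposite s p) ⟩
    lookup v (opposite (shift (negate s) p))  ≡⟨ lookup-reverse v (shift (negate s) p) ⟨
    lookup (reverse v) (shift (negate s) p)   ≡⟨ lookup-rotate (negate s) (reverse v) p ⟨
    lookup (rotate (negate s) (reverse v)) p  ∎
    where open ≡-Reasoning

  record Rotation (v w : Vec A N) : Set where
    constructor rotation
    field
      by      : Fin N
      rotates : rotate by v ≡ w

  Rotation-isEquivalence : IsEquivalence Rotation
  Rotation-isEquivalence = record
    { refl  = rotation zero (rotate-zero _)
    ; sym   = λ { {v} (rotation s refl) → rotation (negate s) (rotate-negate s v) }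
    ; trans = λ { {u} (rotation s refl) (rotation t refl) → rotation (shift s t) (sym (rotate-rotate t s u)) }
    }

  Rotation-reverse : ∀ {v w} → Rotation v w → Rotation (reverse v) (reverse w)
  Rotation-reverse {v} (rotation s refl) = rotation (negate s) (sym (reverse-rotate s v))

  rotate-injective : (v : Vec A N) → Injective _≡_ _≡_ (lookup v) → Injective _≡_ _≡_ (λ s → rotate s v)
  rotate-injective v v-injective {s} {t} rs≡rt = begin
    s                ≡⟨ shift-of-zero s ⟨
    shift s zero     ≡⟨ v-injective (begin
      lookup v (shift s zero)      ≡⟨ lookup-rotate s v zero ⟨
      lookup (rotate s v) zero     ≡⟨ cong (λ u → lookup u zero) rs≡rt ⟩
      lookup (rotate t v) zero     ≡⟨ lookup-rotate t v zero ⟩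
      lookup v (shift t zero)      ∎) ⟩
    shift t zero     ≡⟨ shift-of-zero t ⟩
    t                ∎
    where open ≡-Reasoning

-- As v is injective, reverse v = rotate s v would give −1 − p ≡ p + s for every p:
-- p = 0 forces s = N − 1, and then p = 1 gives N − 2 ≡ 0.
reverse≢rotate : ∀ {k} (v : Vec A (3 + k)) → Injective _≡_ _≡_ (lookup v) → ∀ s → reverse v ≢ rotate s v
reverse≢rotate {k = k} v v-injective s reverse≡rotate = 1+n≢0 (begin
  suc k                         ≡⟨ opposite-prop (suc zero) ⟨
  toℕ (opposite (suc zero))     ≡⟨ cong toℕ (opposite≡shift (suc zero)) ⟩
  toℕ (shift s (suc zero))      ≡⟨ toℕ-shift s (suc zero) ⟩
  suc (toℕ s) % (3 + k)         ≡⟨ cong (λ x → suc x % (3 + k)) toℕs≡2+k ⟩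
  (3 + k) % (3 + k)             ≡⟨ n%n≡0 (3 + k) ⟩
  0                             ∎)
  where
    open ≡-Reasoning
    opposite≡shift : ∀ p → opposite p ≡ shift s p
    opposite≡shift p = v-injective (begin
      lookup v (opposite p)       ≡⟨ lookup-reverse v p ⟨
      lookup (reverse v) p        ≡⟨ cong (λ u → lookup u p) reverse≡rotate ⟩
      lookup (rotate s v) p       ≡⟨ lookup-rotate s v p ⟩
      lookup v (shift s p)        ∎)
    toℕs≡2+k : toℕ s ≡ 2 + k
    toℕs≡2+k = begin
      toℕ s                       ≡⟨ cong toℕ (shift-of-zero s) ⟨
      toℕ (shift s zero)          ≡⟨ cong toℕ (opposite≡shift zero) ⟨
      toℕ (opposite {3 + k} zero) ≡⟨ opposite-prop zero ⟩
      2 + k                       ∎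

-- Hamiltonian sequences of a graph

-- isHamSeqᵇ, sameDirectedᵇ and sameUndirectedᵇ are isHamSeq, sameDirected and sameUndirected of
-- Defs for an arbitrary graph and length; for K_{n_1,…,n_m} and length total m n they coincide
-- definitionally.
module HamiltonianCycles {V : Set} (_≟_ : DecidableEquality V) (adj : V → V → Bool) where

  isHamSeqᵇ : ∀ {L} → Vec V L → Bool
  isHamSeqᵇ {L} v = injectiveᵇ _≟_ (lookup v) ∧ all (λ p → adj (lookup v p) (lookup v (cnext p))) (allFin L)

  sameDirectedᵇ : ∀ {L} → Vec V L → Vec V L → Bool
  sameDirectedᵇ {L} v w = any (λ s → ⌊ Vec-≡-dec _≟_ (rotate s v) w ⌋) (allFin L)

  sameUndirectedᵇ : ∀ {L} → Vec V L → Vec V L → Bool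
  sameUndirectedᵇ v w = sameDirectedᵇ v w ∨ sameDirectedᵇ (reverse v) w

  IsHamSeq : ∀ {L} → Vec V L → Set
  IsHamSeq v = Injective _≡_ _≡_ (lookup v) × (∀ p → T (adj (lookup v p) (lookup v (cnext p))))

  isHamSeqᵇ⇔ : ∀ {L} {v : Vec V L} → T (isHamSeqᵇ v) ⇔ IsHamSeq v
  isHamSeqᵇ⇔ {v = v} = mk⇔ sound complete
    where
      sound : T (isHamSeqᵇ v) → IsHamSeq v
      sound t = to (injectiveᵇ⇔ _≟_ (lookup v)) (proj₁ (to T-∧ t)) , to all-allFin⇔ (proj₂ (to T-∧ t))
      complete : IsHamSeq v → T (isHamSeqᵇ v)
      complete (injective , adjacent) =
        from T-∧ (from (injectiveᵇ⇔ _≟_ (lookup v)) injective , from all-allFin⇔ adjacent)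

  module _ {k : ℕ} where

    private
      N = suc k

    IsHamSeq-rotate : (s : Fin N) {v : Vec V N} → IsHamSeq v → IsHamSeq (rotate s v)
    IsHamSeq-rotate s {v} (v-injective , v-adjacent) =
      (λ {p} {q} eq → shift-injective s (v-injective (trans (sym (lookup-rotate s v p)) (trans eq (lookup-rotate s v q))))) ,
      (λ p → subst T (sym (cong₂ adj (lookup-rotate s v p)
                                    (trans (lookup-rotate s v (cnext p)) (cong (lookup v) (sym (cnext-shift s p))))))
                     (v-adjacent (shift s p)))

    IsHamSeq-reverse : (∀ x y → adj x y ≡ adj y x) → {v : Vec V N} → IsHamSeq v → IsHamSeq (reverse v)
    IsHamSeq-reverse adj-sym {v} (v-injective , v-adjacent) =
      (λ {p} {q} eq → opposite-injective (v-injective (trans (sym (lookup-reverse v p)) (trans eq (lookup-reverse v q))))) ,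
      reverse-adjacent
      where
        opposite-injective : Injective _≡_ _≡_ (opposite {N})
        opposite-injective {x} {y} eq = trans (sym (opposite-involutive x)) (trans (cong opposite eq) (opposite-involutive y))
        reverse-adjacent : ∀ p → T (adj (lookup (reverse v) p) (lookup (reverse v) (cnext p)))
        reverse-adjacent p = subst T (sym (begin
          adj (lookup (reverse v) p) (lookup (reverse v) (cnext p))
            ≡⟨ cong₂ adj (lookup-reverse v p) (lookup-reverse v (cnext p)) ⟩
          adj (lookup v (opposite p)) (lookup v q)
            ≡⟨ adj-sym _ _ ⟩
          adj (lookup v q) (lookup v (opposite p))
            ≡⟨ cong (adj (lookup v q) ∘ lookup v) (cnext-opposite p) ⟨
          adj (lookup v q) (lookup v (cnext q)) ∎))
          (v-adjacent q)
          where
            open ≡-Reasoning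
            q = opposite (cnext p)

    Dihedral : Vec V N → Vec V N → Set
    Dihedral v w = Rotation v w ⊎ Rotation (reverse v) w

    Dihedral-isEquivalence : IsEquivalence Dihedral
    Dihedral-isEquivalence = record { refl = inj₁ R.refl ; sym = D-sym ; trans = D-trans }
      where
        module R = IsEquivalence Rotation-isEquivalence
        unreverse : ∀ v {w} → Rotation (reverse v) w → Rotation v (reverse w)
        unreverse v {w} r = subst (λ u → Rotation u (reverse w)) (reverse-involutive v) (Rotation-reverse r)
        D-sym : ∀ {v w} → Dihedral v w → Dihedral w v
        D-sym     (inj₁ r) = inj₁ (R.sym r)
        D-sym {v} (inj₂ r) = inj₂ (R.sym (unreverse v r))
        D-trans : ∀ {u v w} → Dihedral u v → Dihedral v w → Dihedral u w
        D-trans     (inj₁ r₁) (inj₁ r₂) = inj₁ (R.trans r₁ r₂)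
        D-trans     (inj₁ r₁) (inj₂ r₂) = inj₂ (R.trans (Rotation-reverse r₁) r₂)
        D-trans     (inj₂ r₁) (inj₁ r₂) = inj₂ (R.trans r₁ r₂)
        D-trans {u} (inj₂ r₁) (inj₂ r₂) = inj₁ (R.trans (unreverse u r₁) r₂)

    sameDirectedᵇ⇔ : ∀ {v w : Vec V N} → T (sameDirectedᵇ v w) ⇔ Rotation v w
    sameDirectedᵇ⇔ = mk⇔ (λ t → let s , e = to any-allFin⇔ t in rotation s (toWitness e))
                         (λ (rotation s e) → from any-allFin⇔ (s , fromWitness e))

    sameUndirectedᵇ⇔ : ∀ {v w : Vec V N} → T (sameUndirectedᵇ v w) ⇔ Dihedral v w
    sameUndirectedᵇ⇔ {v} {w} = mk⇔
      (Sum.map (to (sameDirectedᵇ⇔ {v})) (to (sameDirectedᵇ⇔ {reverse v})) ∘ to (T-∨ {sameDirectedᵇ v w}))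
      (from (T-∨ {sameDirectedᵇ v w}) ∘ Sum.map (from (sameDirectedᵇ⇔ {v})) (from (sameDirectedᵇ⇔ {reverse v})))

  module _ {vs : List V} (vs-enumerates : Enumerates _≟_ vs) where

    hamSeqsᵇ : ∀ L → List (Vec V L)
    hamSeqsᵇ L = filterᵇ isHamSeqᵇ (allVec vs L)

    countᵇ-sameDirected : ∀ {k} (z : Vec V (suc k)) → IsHamSeq z →
                          countᵇ (sameDirectedᵇ z) (hamSeqsᵇ (suc k)) ≡ suc k
    countᵇ-sameDirected {k} z z-ham = trans
      (countᵇ-image {_≟_ = Vec-≡-dec _≟_} (λ s → rotate s z) (rotate-injective z (proj₁ z-ham))
                    (allFin⁺ (suc k)) (hamSeqsᵇ (suc k)) rotation-listed-once)
      (length-tabulate (λ i → i))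
      where
        rotation-listed-once : ∀ s → countᵇ (λ y → ⌊ Vec-≡-dec _≟_ (rotate s z) y ⌋) (hamSeqsᵇ (suc k)) ≡ 1
        rotation-listed-once s =
          filterᵇ-enumerates {_≟_ = Vec-≡-dec _≟_} {p = isHamSeqᵇ} {xs = allVec vs (suc k)}
            (allVec-enumerates {_≟_ = _≟_} {xs = vs} vs-enumerates (suc k))
            (rotate s z) (from (isHamSeqᵇ⇔ {v = rotate s z}) (IsHamSeq-rotate s {z} z-ham))

    countᵇ-sameUndirected : (∀ x y → adj x y ≡ adj y x) → ∀ {k} (z : Vec V (3 + k)) → IsHamSeq z →
                            countᵇ (sameUndirectedᵇ z) (hamSeqsᵇ (3 + k)) ≡ 2 * (3 + k)
    countᵇ-sameUndirected adj-sym {k} z z-ham = begin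
      countᵇ (sameUndirectedᵇ z) (hamSeqsᵇ (3 + k))
        ≡⟨ countᵇ-∨ disjoint (hamSeqsᵇ (3 + k)) ⟩
      countᵇ (sameDirectedᵇ z) (hamSeqsᵇ (3 + k)) + countᵇ (sameDirectedᵇ (reverse z)) (hamSeqsᵇ (3 + k))
        ≡⟨ cong₂ _+_ (countᵇ-sameDirected z z-ham)
                     (countᵇ-sameDirected (reverse z) (IsHamSeq-reverse adj-sym {z} z-ham)) ⟩
      (3 + k) + (3 + k)
        ≡⟨ cong ((3 + k) +_) (+-identityʳ (3 + k)) ⟨
      2 * (3 + k) ∎
      where
        open ≡-Reasoning
        module R = IsEquivalence (Rotation-isEquivalence {V} {2 + k})
        disjoint : ∀ y → (sameDirectedᵇ z y ∧ sameDirectedᵇ (reverse z) y) ≡ false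
        disjoint y = ¬T⇒≡false λ both →
          let z↻y , rz↻y   = to (T-∧ {sameDirectedᵇ z y}) both
              rotation s e = R.trans (to (sameDirectedᵇ⇔ {v = z} {w = y}) z↻y)
                                     (R.sym (to (sameDirectedᵇ⇔ {v = reverse z} {w = y}) rz↻y))
          in reverse≢rotate z (proj₁ z-ham) s (sym e)

    private
      hamSeqs-regular : ∀ {k} {r : Vec V (suc k) → Vec V (suc k) → Bool} {c} →
                        (∀ z → IsHamSeq z → countᵇ (r z) (hamSeqsᵇ (suc k)) ≡ c) →
                        All (λ z → countᵇ (r z) (hamSeqsᵇ (suc k)) ≡ c) (hamSeqsᵇ (suc k))
      hamSeqs-regular {k} orbit = All.map (λ {z} z-ham → orbit z (to (isHamSeqᵇ⇔ {v = z}) z-ham))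
                                          (all-filter (T? ∘ isHamSeqᵇ) (allVec vs (suc k)))

    length-hamSeqs≡*directed : ∀ L → 1 ≤ L → length (hamSeqsᵇ L) ≡ L * classes sameDirectedᵇ (hamSeqsᵇ L)
    length-hamSeqs≡*directed _ (s≤s {n = k} _) =
      length≡*classes sameDirectedᵇ
        (isEquivalence-⇔ (λ {v} {w} → sameDirectedᵇ⇔ {v = v} {w = w}) Rotation-isEquivalence)
        (suc k) (hamSeqsᵇ (suc k)) (hamSeqs-regular countᵇ-sameDirected)

    length-hamSeqs≡*undirected : (∀ x y → adj x y ≡ adj y x) →
                                 ∀ L → 3 ≤ L → length (hamSeqsᵇ L) ≡ 2 * L * classes sameUndirectedᵇ (hamSeqsᵇ L)
    length-hamSeqs≡*undirected adj-sym _ (s≤s (s≤s (s≤s {n = k} _))) =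
      length≡*classes sameUndirectedᵇ
        (isEquivalence-⇔ (λ {v} {w} → sameUndirectedᵇ⇔ {v = v} {w = w}) Dihedral-isEquivalence)
        (2 * (3 + k)) (hamSeqsᵇ (3 + k)) (hamSeqs-regular (countᵇ-sameUndirected adj-sym))

    directed≡2*undirected : (∀ x y → adj x y ≡ adj y x) → ∀ L → 3 ≤ L →
                            2 * classes sameUndirectedᵇ (hamSeqsᵇ L) ≡ classes sameDirectedᵇ (hamSeqsᵇ L)
    directed≡2*undirected adj-sym L@(suc _) 3≤L = *-cancelˡ-≡ _ _ L (begin
      L * (2 * undirected)  ≡⟨ x∙yz≈y∙xz L 2 undirected ⟩
      2 * (L * undirected)  ≡⟨ *-assoc 2 L undirected ⟨
      2 * L * undirected    ≡⟨ length-hamSeqs≡*undirected adj-sym L 3≤L ⟨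
      length (hamSeqsᵇ L)   ≡⟨ length-hamSeqs≡*directed L (s≤s z≤n) ⟩
      L * directed          ∎)
      where
        open ≡-Reasoning
        undirected = classes sameUndirectedᵇ (hamSeqsᵇ L)
        directed   = classes sameDirectedᵇ (hamSeqsᵇ L)

-- Sequences without repetition

module _ {V : Set} (_≟_ : DecidableEquality V) where

  _∈ᵇ_ : V → List V → Bool
  x ∈ᵇ U = any (λ y → ⌊ x ≟ y ⌋) U

  freshᵇ : ∀ {L} → List V → Vec V L → Bool
  freshᵇ U []      = true
  freshᵇ U (x ∷ v) = not (x ∈ᵇ U) ∧ freshᵇ (x ∷ U) v

  Fresh : ∀ {L} → List V → Vec V L → Set
  Fresh U v = (∀ p → ¬ T (lookup v p ∈ᵇ U)) × Injective _≡_ _≡_ (lookup v)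

  freshᵇ⇔ : ∀ {L} U (v : Vec V L) → T (freshᵇ U v) ⇔ Fresh U v
  freshᵇ⇔ U []      = mk⇔ (λ _ → (λ ()) , λ {}) _
  freshᵇ⇔ U (x ∷ v) = mk⇔ sound complete
    where
      ∈ᵇ-∷⇔ : ∀ y → T (y ∈ᵇ (x ∷ U)) ⇔ (y ≡ x ⊎ T (y ∈ᵇ U))
      ∈ᵇ-∷⇔ y = mk⇔ (Sum.map₁ toWitness ∘ to (T-∨ {⌊ y ≟ x ⌋}))
                    (from (T-∨ {⌊ y ≟ x ⌋}) ∘ Sum.map₁ fromWitness)
      sound : T (freshᵇ U (x ∷ v)) → Fresh U (x ∷ v)
      sound t = outside , injective
        where
          x∉U = T-not⇒¬T (proj₁ (to T-∧ t))
          v-fresh = to (freshᵇ⇔ (x ∷ U) v) (proj₂ (to (T-∧ {not (x ∈ᵇ U)}) t))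
          outside : ∀ p → ¬ T (lookup (x ∷ v) p ∈ᵇ U)
          outside zero    = x∉U
          outside (suc p) = proj₁ v-fresh p ∘ from (∈ᵇ-∷⇔ (lookup v p)) ∘ inj₂
          injective : Injective _≡_ _≡_ (lookup (x ∷ v))
          injective {zero}  {zero}  _  = refl
          injective {zero}  {suc q} eq = ⊥-elim (proj₁ v-fresh q (from (∈ᵇ-∷⇔ (lookup v q)) (inj₁ (sym eq))))
          injective {suc p} {zero}  eq = ⊥-elim (proj₁ v-fresh p (from (∈ᵇ-∷⇔ (lookup v p)) (inj₁ eq)))
          injective {suc p} {suc q} eq = cong suc (proj₂ v-fresh eq)
      complete : Fresh U (x ∷ v) → T (freshᵇ U (x ∷ v))
      complete (outside , injective) =
        from T-∧ (¬T⇒T-not (outside zero) , from (freshᵇ⇔ (x ∷ U) v) (outside′ , Finₚ.suc-injective ∘ injective))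
        where
          outside′ : ∀ p → ¬ T (lookup v p ∈ᵇ (x ∷ U))
          outside′ p t with to (∈ᵇ-∷⇔ (lookup v p)) t
          ... | inj₁ vp≡x = Finₚ.0≢1+n (sym (injective vp≡x))
          ... | inj₂ vp∈U = outside (suc p) vp∈U

-- Colour words

module _ (m : ℕ) where

  occurrences : ∀ {L} → Vec (Fin m) L → Fin m → ℕ
  occurrences w i = countᵇ (λ c → ⌊ c Fin.≟ i ⌋) (toList w)

  ∑-occurrences : ∀ {L} (w : Vec (Fin m) L) → ∑ (allFin m) (occurrences w) ≡ L
  ∑-occurrences []      = countᵇ-none {p = λ _ → false} (λ _ → refl) (allFin m)
  ∑-occurrences (c ∷ w) = trans (∑-+ (allFin m)) (cong₂ _+_ (listed-once (allFin-enumerates m) c) (∑-occurrences w))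

  -- Counts repetition-free vertex sequences with colour word w when part i has a i unused vertices:
  -- the occurrences of colour i receive an ordered choice of distinct vertices of part i.
  arrangements : ∀ {L} → (Fin m → ℕ) → Vec (Fin m) L → ℕ
  arrangements a w = ∏ (allFin m) (λ i → a i P occurrences w i)

  arrangements-cong : ∀ {L} {a b : Fin m → ℕ} → (∀ i → a i ≡ b i) → (w : Vec (Fin m) L) →
                      arrangements a w ≡ arrangements b w
  arrangements-cong a≗b w = ∏-cong (λ i → cong (_P occurrences w i) (a≗b i)) (allFin m)

  lower : Fin m → (Fin m → ℕ) → Fin m → ℕ
  lower c a i = if ⌊ c Fin.≟ i ⌋ then pred (a i) else a i

  arrangements-∷ : ∀ {L} a c (w : Vec (Fin m) L) → arrangements a (c ∷ w) ≡ a c * arrangements (lower c a) w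
  arrangements-∷ a c w = begin
    ∏ (allFin m) (λ i → a i P occurrences (c ∷ w) i)                      ≡⟨ ∏-cong factor (allFin m) ⟩
    ∏ (allFin m) (λ i → if ⌊ c Fin.≟ i ⌋ then a c * g i else g i)         ≡⟨ ∏-if _ (a c) g (allFin m) ⟩
    a c ^ countᵇ (λ i → ⌊ c Fin.≟ i ⌋) (allFin m) * ∏ (allFin m) g       ≡⟨ cong (λ e → a c ^ e * ∏ (allFin m) g)
                                                                                  (listed-once (allFin-enumerates m) c) ⟩
    a c ^ 1 * ∏ (allFin m) g                                              ≡⟨ cong (_* ∏ (allFin m) g) (*-identityʳ (a c)) ⟩
    a c * arrangements (lower c a) w                                      ∎
    where
      open ≡-Reasoning
      g : Fin m → ℕ
      g i = lower c a i P occurrences w i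
      factor : ∀ i → a i P occurrences (c ∷ w) i ≡ (if ⌊ c Fin.≟ i ⌋ then a c * g i else g i)
      factor i with c Fin.≟ i
      ... | yes refl = P-suc (a c) (occurrences w c)
      ... | no  _    = refl

-- The complete multipartite graph

module _ (m : ℕ) (n : Fin m → ℕ) where

  private
    _≟ᵥ_ : DecidableEquality (Vertex m n)
    _≟ᵥ_ = _≟V_ m n

    _∈ᵥ_ : Vertex m n → List (Vertex m n) → Bool
    _∈ᵥ_ = _∈ᵇ_ _≟ᵥ_

  vertices-enumerates : Enumerates _≟ᵥ_ (vertices m n)
  vertices-enumerates = concatMap-enumerates Fin._≟_ Fin._≟_ (allFin-enumerates m) (λ i → allFin-enumerates (n i))

  free : List (Vertex m n) → Fin m → ℕ
  free U i = countᵇ (λ j → not ((i , j) ∈ᵥ U)) (allFin (n i))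

  free-[] : ∀ i → free [] i ≡ n i
  free-[] i = trans (countᵇ-all (λ _ → refl) (allFin (n i))) (length-tabulate (λ j → j))

  free-∷ : ∀ {c j U} → ¬ T ((c , j) ∈ᵥ U) → ∀ i → free ((c , j) ∷ U) i ≡ lower m c (free U) i
  free-∷ {c} {j} {U} cj∉U i = by-cases (c Fin.≟ i)
    where
      by-cases : (c≟i : Dec (c ≡ i)) → free ((c , j) ∷ U) i ≡ (if ⌊ c≟i ⌋ then pred (free U i) else free U i)
      by-cases (yes refl) = sym (cong pred (trans (countᵇ-remove (allFin-enumerates (n c)) j (¬T⇒T-not cj∉U))
                                                  (cong suc (countᵇ-cong j-removed (allFin (n c))))))
        where
          j-removed : ∀ j′ → (not ⌊ j Fin.≟ j′ ⌋ ∧ not ((c , j′) ∈ᵥ U))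
                             ≡ not (⌊ (c , j′) ≟ᵥ (c , j) ⌋ ∨ (c , j′) ∈ᵥ U)
          j-removed j′ = trans (cong (λ b → not b ∧ not ((c , j′) ∈ᵥ U))
                                     (⌊⌋-⇔ (cong (c ,_) ∘ sym) (λ { refl → refl }) (j Fin.≟ j′) ((c , j′) ≟ᵥ (c , j))))
                               (sym (not-∨ ⌊ (c , j′) ≟ᵥ (c , j) ⌋ ((c , j′) ∈ᵥ U)))
      by-cases (no c≢i) = countᵇ-cong (λ j′ → cong (λ b → not (b ∨ (i , j′) ∈ᵥ U))
                                                  (⌊⌋-false (_ ≟ᵥ _) (c≢i ∘ sym ∘ cong proj₁)))
                                      (allFin (n i))

  extensions : ∀ {L} → (Vec (Fin m) L → Bool) → List (Vertex m n) → ℕ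
  extensions {L} q U = ∑ (allVec (allFin m) L) (λ w → if q w then arrangements m (free U) w else 0)

  ∑-choices-in-part : ∀ {L} (q : Vec (Fin m) (suc L) → Bool) U c →
                      ∑ (allFin (n c)) (λ j → if not ((c , j) ∈ᵥ U) then extensions (q ∘ (c ∷_)) ((c , j) ∷ U) else 0)
                      ≡ ∑ (allVec (allFin m) L) (λ w → if q (c ∷ w) then arrangements m (free U) (c ∷ w) else 0)
  ∑-choices-in-part {L} q U c = begin
    ∑ (allFin (n c)) (λ j → if not ((c , j) ∈ᵥ U) then extensions (q ∘ (c ∷_)) ((c , j) ∷ U) else 0)
      ≡⟨ ∑-cong same-extensions (allFin (n c)) ⟩
    ∑ (allFin (n c)) (λ j → if not ((c , j) ∈ᵥ U) then lowered else 0)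
      ≡⟨ ∑-indicator _ lowered (allFin (n c)) ⟩
    free U c * lowered
      ≡⟨ ∑-*ˡ (free U c) _ (allVec (allFin m) L) ⟨
    ∑ (allVec (allFin m) L) (λ w → free U c * (if q (c ∷ w) then arrangements m (lower m c (free U)) w else 0))
      ≡⟨ ∑-cong (λ w → trans (if-float (free U c *_) (q (c ∷ w)))
                             (if-cong₂ (q (c ∷ w)) (sym (arrangements-∷ m (free U) c w)) (*-zeroʳ (free U c))))
                (allVec (allFin m) L) ⟩
    ∑ (allVec (allFin m) L) (λ w → if q (c ∷ w) then arrangements m (free U) (c ∷ w) else 0) ∎
    where
      open ≡-Reasoning
      lowered = ∑ (allVec (allFin m) L) (λ w → if q (c ∷ w) then arrangements m (lower m c (free U)) w else 0)
      same-extensions : ∀ j → (if not ((c , j) ∈ᵥ U) then extensions (q ∘ (c ∷_)) ((c , j) ∷ U) else 0)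
                              ≡ (if not ((c , j) ∈ᵥ U) then lowered else 0)
      same-extensions j with (c , j) ∈ᵥ U in cj∈U
      ... | true  = refl
      ... | false = ∑-cong (λ w → if-cong-then (q (c ∷ w)) (arrangements-cong m (free-∷ {c} {j} {U} (subst T cj∈U)) w))
                           (allVec (allFin m) L)

  countᵇ-fresh : ∀ L (q : Vec (Fin m) L → Bool) U →
                 countᵇ (λ v → q (Vec.map proj₁ v) ∧ freshᵇ _≟ᵥ_ U v) (allVec (vertices m n) L) ≡ extensions q U
  countᵇ-fresh zero q U with q []
  ... | true  = sym (trans (+-identityʳ _) (∏-ones (allFin m)))
  ... | false = refl
  countᵇ-fresh (suc L) q U = begin
    countᵇ (λ v → q (Vec.map proj₁ v) ∧ freshᵇ _≟ᵥ_ U v) (allVec (vertices m n) (suc L))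
      ≡⟨ ∑-concatMap-map _ (λ x → x ∷_) (λ _ → allVec (vertices m n) L) (vertices m n) ⟩
    ∑ (vertices m n) (λ x → countᵇ (λ v → q (proj₁ x ∷ Vec.map proj₁ v) ∧ freshᵇ _≟ᵥ_ U (x ∷ v)) (allVec (vertices m n) L))
      ≡⟨ ∑-cong first-vertex (vertices m n) ⟩
    ∑ (vertices m n) (λ x → if not (x ∈ᵥ U) then extensions (q ∘ (proj₁ x ∷_)) (x ∷ U) else 0)
      ≡⟨ ∑-concatMap-map _ _,_ (λ i → allFin (n i)) (allFin m) ⟩
    ∑ (allFin m) (λ c → ∑ (allFin (n c)) (λ j → if not ((c , j) ∈ᵥ U) then extensions (q ∘ (c ∷_)) ((c , j) ∷ U) else 0))
      ≡⟨ ∑-cong (∑-choices-in-part q U) (allFin m) ⟩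
    ∑ (allFin m) (λ c → ∑ (allVec (allFin m) L) (λ w → if q (c ∷ w) then arrangements m (free U) (c ∷ w) else 0))
      ≡⟨ ∑-concatMap-map _ (λ c → c ∷_) (λ _ → allVec (allFin m) L) (allFin m) ⟨
    extensions q U ∎
    where
      open ≡-Reasoning
      first-vertex : ∀ x → countᵇ (λ v → q (proj₁ x ∷ Vec.map proj₁ v) ∧ freshᵇ _≟ᵥ_ U (x ∷ v)) (allVec (vertices m n) L)
                           ≡ (if not (x ∈ᵥ U) then extensions (q ∘ (proj₁ x ∷_)) (x ∷ U) else 0)
      first-vertex x with x ∈ᵥ U
      ... | true  = countᵇ-none (λ _ → ∧-zeroʳ _) (allVec (vertices m n) L)
      ... | false = countᵇ-fresh L (q ∘ (proj₁ x ∷_)) (x ∷ U)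

  adjacent-sym : ∀ x y → adjacent m n x y ≡ adjacent m n y x
  adjacent-sym x y = cong not (⌊⌋-⇔ sym sym (proj₁ x Fin.≟ proj₁ y) (proj₁ y Fin.≟ proj₁ x))

  alternatingᵇ : ∀ {L} → Vec (Fin m) L → Bool
  alternatingᵇ {L} w = all (λ p → not ⌊ lookup w p Fin.≟ lookup w (cnext p) ⌋) (allFin L)

  open HamiltonianCycles _≟ᵥ_ (adjacent m n) using (isHamSeqᵇ)

  isHamSeqᵇ≡ : ∀ {L} (v : Vec (Vertex m n) L) →
               isHamSeqᵇ v ≡ alternatingᵇ (Vec.map proj₁ v) ∧ freshᵇ _≟ᵥ_ [] v
  isHamSeqᵇ≡ {L} v = trans (cong₂ _∧_ injective≡fresh follows≡alternating) (∧-comm (freshᵇ _≟ᵥ_ [] v) _)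
    where
      injective≡fresh : injectiveᵇ _≟ᵥ_ (lookup v) ≡ freshᵇ _≟ᵥ_ [] v
      injective≡fresh = T-injective
        (λ t → from (freshᵇ⇔ _≟ᵥ_ [] v) ((λ _ ()) , to (injectiveᵇ⇔ _≟ᵥ_ (lookup v)) t))
        (λ t → from (injectiveᵇ⇔ _≟ᵥ_ (lookup v)) (proj₂ (to (freshᵇ⇔ _≟ᵥ_ [] v) t)))
      follows≡alternating : all (λ p → adjacent m n (lookup v p) (lookup v (cnext p))) (allFin L)
                            ≡ alternatingᵇ (Vec.map proj₁ v)
      follows≡alternating = cong and (map-cong (λ p → cong₂ (λ a b → not ⌊ a Fin.≟ b ⌋)
                                                      (sym (lookup-map p proj₁ v)) (sym (lookup-map (cnext p) proj₁ v)))
                                               (allFin L))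

  colourCount≡occurrences : ∀ w i → colourCount m n w i ≡ occurrences m w i
  colourCount≡occurrences w i = trans (length-filterᵇ (allFin (total m n))) (∑-allFin-lookup _ w)

  arrangements-free[] : ∀ w → arrangements m (free []) w
                              ≡ (if all (λ i → colourCount m n w i ≡ᵇ n i) (allFin m) then prodFact m n else 0)
  arrangements-free[] w = begin
    arrangements m (free []) w
      ≡⟨ arrangements-cong m free-[] w ⟩
    arrangements m n w
      ≡⟨ ∏-P (allFin m) (∑-occurrences m w) ⟩
    (if all (λ i → occurrences m w i ≡ᵇ n i) (allFin m) then prodFact m n else 0)
      ≡⟨ cong (λ b → if b then prodFact m n else 0)
              (cong and (map-cong (λ i → cong (_≡ᵇ n i) (sym (colourCount≡occurrences w i))) (allFin m))) ⟩
    (if all (λ i → colourCount m n w i ≡ᵇ n i) (allFin m) then prodFact m n else 0) ∎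
    where open ≡-Reasoning

  countᵇ-hamSeqs : countᵇ (isHamSeq m n) (allVec (vertices m n) (total m n)) ≡ properWords m n * prodFact m n
  countᵇ-hamSeqs = begin
    countᵇ isHamSeqᵇ (allVec (vertices m n) (total m n))
      ≡⟨ countᵇ-cong isHamSeqᵇ≡ (allVec (vertices m n) (total m n)) ⟩
    countᵇ (λ v → alternatingᵇ (Vec.map proj₁ v) ∧ freshᵇ _≟ᵥ_ [] v) (allVec (vertices m n) (total m n))
      ≡⟨ countᵇ-fresh (total m n) alternatingᵇ [] ⟩
    extensions {total m n} alternatingᵇ []
      ≡⟨ ∑-cong proper words ⟩
    ∑ words (λ w → if isProperCyclicWord m n w then prodFact m n else 0)
      ≡⟨ ∑-indicator (isProperCyclicWord m n) (prodFact m n) words ⟩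
    countᵇ (isProperCyclicWord m n) words * prodFact m n
      ≡⟨ cong (_* prodFact m n) (length-filterᵇ words) ⟨
    properWords m n * prodFact m n ∎
    where
      open ≡-Reasoning
      words = allVec (allFin m) (total m n)
      proper : ∀ w → (if alternatingᵇ w then arrangements m (free []) w else 0)
                     ≡ (if isProperCyclicWord m n w then prodFact m n else 0)
      proper w rewrite arrangements-free[] w
        with all (λ i → colourCount m n w i ≡ᵇ n i) (allFin m) | alternatingᵇ w
      ... | true  | true  = refl
      ... | true  | false = refl
      ... | false | true  = refl
      ... | false | false = refl

total-positive : ∀ {m} (n : Fin m → ℕ) → 1 ≤ m → (∀ i → 1 ≤ n i) → 1 ≤ total m n
total-positive {suc m} n _ n≥1 = ≤-trans (n≥1 zero) (subst (n zero ≤_) (sym (∑-allFin-suc n)) (m≤m+n (n zero) _))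

mainTheorem10 : (m : ℕ) → 2 ≤ m → (n : Fin m → ℕ) → (∀ i → 1 ≤ n i) →
    (total m n * hamDirected m n ≡ prodFact m n * properWords m n)
    × (3 ≤ total m n → 2 * hamUndirected m n ≡ hamDirected m n)
mainTheorem10 m 2≤m n n≥1 = directed , undirected
  where
    open HamiltonianCycles (_≟V_ m n) (adjacent m n)
    open ≡-Reasoning
    1≤total : 1 ≤ total m n
    1≤total = total-positive n (≤-trans (s≤s z≤n) 2≤m) n≥1
    directed : total m n * hamDirected m n ≡ prodFact m n * properWords m n
    directed = begin
      total m n * hamDirected m n
        ≡⟨ length-hamSeqs≡*directed (vertices-enumerates m n) (total m n) 1≤total ⟨
      length (hamSeqs m n)
        ≡⟨ length-filterᵇ (allVec (vertices m n) (total m n)) ⟩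
      countᵇ (isHamSeq m n) (allVec (vertices m n) (total m n))
        ≡⟨ countᵇ-hamSeqs m n ⟩
      properWords m n * prodFact m n
        ≡⟨ *-comm (properWords m n) (prodFact m n) ⟩
      prodFact m n * properWords m n ∎
    undirected : 3 ≤ total m n → 2 * hamUndirected m n ≡ hamDirected m n
    undirected = directed≡2*undirected (vertices-enumerates m n) (adjacent-sym m n) (total m n)
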